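{- The matroid $E_1^*$ has a ring of bowties $T_0,D_0,T_1,D_1,\dots,T_k,D_k$ with $T_j=\{a_j,b_j,c_j\}$ such that $E_1^*\backslash\{c_0,c_1,\dots,c_k\}$ is isomorphic to $S^*$; that is, $S^*$ can be obtained from $E_1^*$ by trimming a ring of bowties.
   Context: Let $M$ be a matroid and $k\ge2$. A ring of bowties in $M$ is a sequence $T_0,D_0,T_1,D_1,\dots,T_k,D_k$ where $T_0,\dots,T_k$ are pairwise disjoint triangles of $M$, $T_j=\{a_j,b_j,c_j\}$, $D_j=\{b_j,c_j,a_{j+1},b_{j+1}\}$ is a cocircuit of $M$ for $j\in\{0,\dots,k-1\}$, and $D_k=\{b_k,c_k,a_0,b_0\}$ is a cocircuit of $M$. Deleting $\{c_0,\dots,c_k\}$ is called trimming the ring of bowties. For an $r\times m$ matrix $X$ over $\mathrm{GF}(2)$, $M[I_r|X]$ is the binary matroid represented by $[I_r|X]$. Let $E$ be the $5\times6$ matrix with rows $(1,0,0,1,1,1),(1,1,0,0,1,0),(0,1,1,0,1,1),(0,0,1,1,1,0),(1,0,0,1,0,1)$, and $S=M[I_5|E]$. Let $E_1=M[I_9|E_1']$, where $E_1'$ is the $9\times6$ matrix consisting of the rows of $E$ followed by $(1,0,0,0,1,0),(1,0,0,0,0,1),(0,1,0,1,0,1),(0,0,1,1,0,0)$. -}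

module Defs where

open import Data.Bool using (Bool; true; false; _xor_; if_then_else_)
open import Data.Nat using (ℕ; zero; suc; _+_; _≤_)
open import Data.Nat.DivMod using (_mod_)
open import Data.Fin using (Fin; zero; suc; splitAt; _≟_; toℕ)
open import Data.Fin.Subset using (Subset; _∈_; _⊆_; ∁; ⁅_⁆; _∪_; _-_; Nonempty; ⊥; ∣_∣)
open import Data.Vec using (Vec; []; _∷_; lookup)
open import Data.Sum using (inj₁; inj₂)
open import Data.Product using (Σ; ∃; _×_; _,_)
open import Relation.Nullary using (¬_)
open import Relation.Nullary.Decidable using (⌊_⌋)
open import Relation.Binary.PropositionalEquality using (_≡_; _≢_)
open import Function using (_∘_)
open import Function.Definitions using (Injective)

-- GF(2) is modelled by Bool with addition _xor_ (0 = false, 1 = true).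
-- An r × n matrix over GF(2).
Matrix : ℕ → ℕ → Set
Matrix r n = Fin r → Fin n → Bool

stdRep : ∀ {r m} → Matrix r m → Matrix r (r + m)
stdRep {r} X i j with splitAt r j
... | inj₁ j' = ⌊ i ≟ j' ⌋
... | inj₂ j' = X i j'

colSum : ∀ {r n} → Matrix r n → Subset n → Fin r → Bool
colSum {n = zero}  A []           i = false
colSum {n = suc n} A (true ∷ Y)  i = A i zero xor colSum (λ i' j → A i' (suc j)) Y i
colSum {n = suc n} A (false ∷ Y) i = colSum (λ i' j → A i' (suc j)) Y i

record Matroid (n : ℕ) : Set₁ where
  field
    Ind : Subset n → Set
open Matroid public

vecMatroid : ∀ {r n} → Matrix r n → Matroid n
Ind (vecMatroid A) X =
  ∀ Y → Y ⊆ X → Nonempty Y → ¬ (∀ i → colSum A Y i ≡ false)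

M[I|_] : ∀ {r m} → Matrix r m → Matroid (r + m)
M[I| X ] = vecMatroid (stdRep X)

Basis : ∀ {n} → Matroid n → Subset n → Set
Basis M B = Ind M B × (∀ X → B ⊆ X → Ind M X → X ⊆ B)

dual : ∀ {n} → Matroid n → Matroid n
Ind (dual M) X = ∃ λ B → Basis M B × B ⊆ ∁ X

Circuit : ∀ {n} → Matroid n → Subset n → Set
Circuit M C = ¬ Ind M C × (∀ e → e ∈ C → Ind M (C - e))

Cocircuit : ∀ {n} → Matroid n → Subset n → Set
Cocircuit M = Circuit (dual M)

img : ∀ {m n} → (Fin m → Fin n) → Subset m → Subset n
img {zero}  f []          = ⊥
img {suc m} f (true ∷ Y)  = ⁅ f zero ⁆ ∪ img (f ∘ suc) Y
img {suc m} f (false ∷ Y) = img (f ∘ suc) Y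

-- N ≅ M \ X : there is an injection f : E(N) → E(M) whose image is exactly
-- E(M) − X, such that Y is independent in N iff f(Y) is independent in M
-- (the independent sets of M \ X are the independent sets of M avoiding X).
IsoToDeletion : ∀ {m n} → Matroid m → Matroid n → Subset n → Set
IsoToDeletion {m} {n} N M X =
  Σ (Fin m → Fin n) λ f →
    Injective _≡_ _≡_ f
    × (∀ i → ¬ (f i ∈ X))
    × (∀ e → ¬ (e ∈ X) → ∃ λ i → f i ≡ e)
    × (∀ Y → (Ind N Y → Ind M (img f Y)) × (Ind M (img f Y) → Ind N Y))

Triangle : ∀ {n} → Matroid n → Subset n → Set
Triangle M T = Circuit M T × ∣ T ∣ ≡ 3

next : ∀ {k} → Fin (suc k) → Fin (suc k)
next {k} j = suc (toℕ j) mod suc k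

triElt : ∀ {k n} → (a b c : Fin (suc k) → Fin n) → Fin (suc k) → Fin 3 → Fin n
triElt a b c j zero             = a j
triElt a b c j (suc zero)       = b j
triElt a b c j (suc (suc zero)) = c j

Tri : ∀ {k n} → (a b c : Fin (suc k) → Fin n) → Fin (suc k) → Subset n
Tri a b c j = ⁅ a j ⁆ ∪ (⁅ b j ⁆ ∪ ⁅ c j ⁆)

Dset : ∀ {k n} → (a b c : Fin (suc k) → Fin n) → Fin (suc k) → Subset n
Dset a b c j = ⁅ b j ⁆ ∪ (⁅ c j ⁆ ∪ (⁅ a (next j) ⁆ ∪ ⁅ b (next j) ⁆))

-- T_0, D_0, ..., T_k, D_k is a ring of bowties in M (k ≥ 2):
-- the triangles T_j = {a_j,b_j,c_j} are pairwise disjoint 3-element sets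
-- (all a_j, b_j, c_j distinct), each T_j is a triangle, each D_j a cocircuit.
RingOfBowties : ∀ {n} → Matroid n → (k : ℕ) → (a b c : Fin (suc k) → Fin n) → Set
RingOfBowties M k a b c =
  2 ≤ k
  × (∀ j j' t t' → triElt a b c j t ≡ triElt a b c j' t' → j ≡ j' × t ≡ t')
  × (∀ j → Triangle M (Tri a b c j))
  × (∀ j → Cocircuit M (Dset a b c j))

cSet : ∀ {k n} → (Fin (suc k) → Fin n) → Subset n
cSet {zero}  c = ⁅ c zero ⁆
cSet {suc k} c = ⁅ c zero ⁆ ∪ cSet (c ∘ suc)

O I : Bool
O = false
I = true

Emat : Matrix 5 6
Emat i j = lookup (lookup rows i) j
  where
  rows : Vec (Vec Bool 6) 5
  rows = (I ∷ O ∷ O ∷ I ∷ I ∷ I ∷ [])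
       ∷ (I ∷ I ∷ O ∷ O ∷ I ∷ O ∷ [])
       ∷ (O ∷ I ∷ I ∷ O ∷ I ∷ I ∷ [])
       ∷ (O ∷ O ∷ I ∷ I ∷ I ∷ O ∷ [])
       ∷ (I ∷ O ∷ O ∷ I ∷ O ∷ I ∷ [])
       ∷ []

E1'mat : Matrix 9 6
E1'mat i j = lookup (lookup rows i) j
  where
  rows : Vec (Vec Bool 6) 9
  rows = (I ∷ O ∷ O ∷ I ∷ I ∷ I ∷ [])
       ∷ (I ∷ I ∷ O ∷ O ∷ I ∷ O ∷ [])
       ∷ (O ∷ I ∷ I ∷ O ∷ I ∷ I ∷ [])
       ∷ (O ∷ O ∷ I ∷ I ∷ I ∷ O ∷ [])
       ∷ (I ∷ O ∷ O ∷ I ∷ O ∷ I ∷ [])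
       ∷ (I ∷ O ∷ O ∷ O ∷ I ∷ O ∷ [])
       ∷ (I ∷ O ∷ O ∷ O ∷ O ∷ I ∷ [])
       ∷ (O ∷ I ∷ O ∷ I ∷ O ∷ I ∷ [])
       ∷ (O ∷ O ∷ I ∷ I ∷ O ∷ O ∷ [])
       ∷ []

S : Matroid 11
S = M[I| Emat ]

E₁ : Matroid 15
E₁ = M[I| E1'mat ]

module Submission where

-- Everything reduces to linear algebra over GF(2).  For a vector matroid
-- M = M[A] a set X is independent in M* exactly when the columns outside X
-- span the column space of A (dualInd⇒coSpans, coSpans⇒dualInd, proved via
-- greedy extension of an independent set to a basis).  For a standard
-- representation A = [I_r | X] spanning is witnessed cheaply: the unit vector
-- e_k is the sum of the X-columns in a set s together with the identity
-- columns on the support of e_k + Xs (Standard.unitWitness).  Dually, a set T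
-- is dependent in M* when some sum of rows of A is the indicator vector of T.
-- These certificates are decidable, so the four triangles of E₁* are checked
-- by evaluation (Standard.certified-triangle); the four sets D_j are circuits
-- of E₁ and hence cocircuits of E₁* (circuit⇒cocircuit-of-dual).
--
-- The isomorphism S* ≅ E₁* \ {c₀,…,c₃} sends the columns of S to the columns
-- of E₁ outside C = {c₀,…,c₃}, which are the identity columns of the four
-- extra rows of E₁′.  Modulo the span of C, the columns of E₁ are the
-- columns of S, so ∁Y spans S iff ∁φ(Y) spans E₁; by the duality criterion
-- this is the required correspondence of independent sets.

open import Defs
open import Data.Nat using (ℕ; suc)
open import Data.Fin using (Fin)
open import Data.Product using (Σ; _×_)

import Data.Nat as Nat
open import Data.Nat using (_+_; z≤n; s≤s) renaming (_≟_ to _≟ⁿ_)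
open import Data.Bool using (Bool; true; false; _xor_; _∧_)
open import Data.Bool.Properties
  using (xor-assoc; xor-comm; xor-same; xor-identityʳ; ∧-identityʳ; ∧-zeroʳ; ∧-distribˡ-xor; ∧-distribʳ-xor)
  renaming (_≟_ to _≟ᵇ_)
open import Data.Fin using (zero; suc; _≟_; _↑ˡ_; _↑ʳ_; splitAt; #_)
open import Data.Fin.Properties using (suc-injective; all?; any?; splitAt-↑ˡ; splitAt-↑ʳ; ↑ˡ-injective)
open import Data.Fin.Subset
  using (Subset; inside; outside; _∈_; _∉_; _⊆_; ∁; ⁅_⁆; _∪_; _-_; Nonempty; ⊤; ∣_∣)
  renaming (⊥ to ∅)
open import Data.Fin.Subset.Properties
  using (_∈?_; _⊆?_; anySubset?; nonempty?; drop-∷-⊆; out⊆; in⊆in; ∉⊥; ∈⊤; ⊆⊤; x∈⁅x⁆; x∈⁅y⁆⇒x≡y;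
         x∈p∪q⁺; x∈p∪q⁻; p⊆p∪q; x∈∁p⇒x∉p; x∉p⇒x∈∁p; x∉∁p⇒x∈p; x∈p⇒x∉∁p; p─q⊆p; p─⊥≡p)
open import Data.Vec using ([]; _∷_; here; there; lookup; zipWith; tabulate; _++_)
open import Data.Vec.Properties using ([]=⇒lookup; lookup⇒[]=; lookup∘tabulate)
open import Data.List using (List; allFin) renaming ([] to []ˡ; _∷_ to _∷ˡ_)
open import Data.List.Membership.Propositional using () renaming (_∈_ to _∈ˡ_)
open import Data.List.Membership.Propositional.Properties using (∈-allFin)
open import Data.List.Relation.Unary.Any using () renaming (here to hereˡ; there to thereˡ)
open import Data.Sum using (_⊎_; inj₁; inj₂; [_,_]′)
import Data.Sum as Sum
import Data.Product as Product
open import Data.Product using (_,_; ∃; proj₁)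
open import Data.Empty using (⊥-elim)
open import Data.Unit using (tt)
open import Relation.Nullary using (¬_; Dec; yes; no; contradiction)
open import Relation.Nullary.Decidable using (⌊_⌋; toWitness; _×-dec_; _→-dec_; _⊎-dec_; ¬?)
open import Relation.Binary.PropositionalEquality
  using (_≡_; _≢_; refl; sym; trans; cong; cong₂; subst; module ≡-Reasoning)
open import Function using (_∘_; id)
open import Function.Definitions using (Injective)

open ≡-Reasoning

xor-swap : ∀ x y z → x xor (y xor z) ≡ y xor (x xor z)
xor-swap x y z = begin
  x xor (y xor z)  ≡⟨ sym (xor-assoc x y z) ⟩
  (x xor y) xor z  ≡⟨ cong (_xor z) (xor-comm x y) ⟩
  (y xor x) xor z  ≡⟨ xor-assoc y x z ⟩
  y xor (x xor z)  ∎

xor-interchange : ∀ w x y z → (w xor x) xor (y xor z) ≡ (w xor y) xor (x xor z)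
xor-interchange w x y z = begin
  (w xor x) xor (y xor z)  ≡⟨ xor-assoc w x (y xor z) ⟩
  w xor (x xor (y xor z))  ≡⟨ cong (w xor_) (xor-swap x y z) ⟩
  w xor (y xor (x xor z))  ≡⟨ sym (xor-assoc w y (x xor z)) ⟩
  (w xor y) xor (x xor z)  ∎

xor≡false⇒≡ : ∀ x y → x xor y ≡ false → x ≡ y
xor≡false⇒≡ false false _ = refl
xor≡false⇒≡ true  true  _ = refl

xor-cancelˡ : ∀ x y → x xor (x xor y) ≡ y
xor-cancelˡ x y = trans (sym (xor-assoc x x y)) (cong (_xor y) (xor-same x))

δ : ∀ {n} → Fin n → Fin n → Bool
δ i k = ⌊ i ≟ k ⌋

unit : ∀ {n} → Fin n → Fin n → Bool
unit k i = δ i k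

δ-diag : ∀ {n} (i : Fin n) → δ i i ≡ true
δ-diag i with i ≟ i
... | yes _   = refl
... | no i≢i = contradiction refl i≢i

δ-off : ∀ {n} {i k : Fin n} → i ≢ k → δ i k ≡ false
δ-off {i = i} {k} i≢k with i ≟ k
... | yes i≡k = contradiction i≡k i≢k
... | no _    = refl

δ-injective : ∀ {m n} (f : Fin m → Fin n) → Injective _≡_ _≡_ f → ∀ i k → δ (f i) (f k) ≡ δ i k
δ-injective f f-inj i k with i ≟ k
... | yes refl = δ-diag (f i)
... | no i≢k  = δ-off (i≢k ∘ f-inj)

δ-suc : ∀ {n} (i k : Fin n) → δ (suc i) (suc k) ≡ δ i k
δ-suc = δ-injective suc suc-injective

_⊕_ : ∀ {n} → Subset n → Subset n → Subset n
P ⊕ Q = zipWith _xor_ P Q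

∈-⊕ : ∀ {n} {x : Fin n} (P Q : Subset n) → x ∈ P ⊕ Q → x ∈ P ⊎ x ∈ Q
∈-⊕ (inside  ∷ P) (outside ∷ Q) here      = inj₁ here
∈-⊕ (outside ∷ P) (inside  ∷ Q) here      = inj₂ here
∈-⊕ (_       ∷ P) (_       ∷ Q) (there m) = Sum.map there there (∈-⊕ P Q m)

∉-remove : ∀ {n} (Y : Subset n) e → e ∉ Y - e
∉-remove (_ ∷ Y) zero    ()
∉-remove (_ ∷ Y) (suc e) (there m) = ∉-remove Y e m

∪-⊆ : ∀ {n} {P Q Z : Subset n} → P ⊆ Z → Q ⊆ Z → P ∪ Q ⊆ Z
∪-⊆ {P = P} {Q} P⊆Z Q⊆Z m = [ P⊆Z , Q⊆Z ]′ (x∈p∪q⁻ P Q m)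

⁅⁆-⊆ : ∀ {n} {e : Fin n} {Z} → e ∈ Z → ⁅ e ⁆ ⊆ Z
⁅⁆-⊆ {e = e} {Z} e∈Z m = subst (_∈ Z) (sym (x∈⁅y⁆⇒x≡y e m)) e∈Z

sumOver : ∀ {n} → Subset n → (Fin n → Bool) → Bool
sumOver []      g = false
sumOver (b ∷ P) g = (b ∧ g zero) xor sumOver P (g ∘ suc)

colSum≡sumOver : ∀ {r n} (A : Matrix r n) Y i → colSum A Y i ≡ sumOver Y (λ j → A i j)
colSum≡sumOver A []          i = refl
colSum≡sumOver A (true  ∷ Y) i = cong (A i zero xor_) (colSum≡sumOver (λ i' j → A i' (suc j)) Y i)
colSum≡sumOver A (false ∷ Y) i = colSum≡sumOver (λ i' j → A i' (suc j)) Y i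

sumOver-cong : ∀ {n} (P : Subset n) {g h : Fin n → Bool} → (∀ {j} → j ∈ P → g j ≡ h j) →
  sumOver P g ≡ sumOver P h
sumOver-cong []            eq = refl
sumOver-cong (inside  ∷ P) eq = cong₂ _xor_ (eq here) (sumOver-cong P (eq ∘ there))
sumOver-cong (outside ∷ P) eq = sumOver-cong P (eq ∘ there)

sumOver-agree : ∀ {n} (P Q : Subset n) g → (∀ j → g j ≡ true → lookup P j ≡ lookup Q j) →
  sumOver P g ≡ sumOver Q g
sumOver-agree []      []      g agree = refl
sumOver-agree (p ∷ P) (q ∷ Q) g agree =
  cong₂ _xor_ (masked (g zero) (agree zero)) (sumOver-agree P Q (g ∘ suc) (agree ∘ suc))
  where
  masked : ∀ x → (x ≡ true → p ≡ q) → p ∧ x ≡ q ∧ x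
  masked false _  = trans (∧-zeroʳ p) (sym (∧-zeroʳ q))
  masked true  eq = trans (∧-identityʳ p) (trans (eq refl) (sym (∧-identityʳ q)))

sumOver-zero : ∀ {n} (P : Subset n) → sumOver P (λ _ → false) ≡ false
sumOver-zero []      = refl
sumOver-zero (p ∷ P) = cong₂ _xor_ (∧-zeroʳ p) (sumOver-zero P)

sumOver-∅ : ∀ {n} (g : Fin n → Bool) → sumOver ∅ g ≡ false
sumOver-∅ {Nat.zero} g = refl
sumOver-∅ {suc n}    g = sumOver-∅ (g ∘ suc)

sumOver-linear : ∀ {n} (P : Subset n) u v → sumOver P (λ j → u j xor v j) ≡ sumOver P u xor sumOver P v
sumOver-linear []      u v = refl
sumOver-linear (p ∷ P) u v = begin
  (p ∧ (u zero xor v zero)) xor sumOver P (λ j → u (suc j) xor v (suc j))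
    ≡⟨ cong₂ _xor_ (∧-distribˡ-xor p (u zero) (v zero)) (sumOver-linear P (u ∘ suc) (v ∘ suc)) ⟩
  ((p ∧ u zero) xor (p ∧ v zero)) xor (sumOver P (u ∘ suc) xor sumOver P (v ∘ suc))
    ≡⟨ xor-interchange (p ∧ u zero) (p ∧ v zero) (sumOver P (u ∘ suc)) (sumOver P (v ∘ suc)) ⟩
  sumOver (p ∷ P) u xor sumOver (p ∷ P) v ∎

sumOver-⊕ : ∀ {n} (P Q : Subset n) g → sumOver (P ⊕ Q) g ≡ sumOver P g xor sumOver Q g
sumOver-⊕ []      []      g = refl
sumOver-⊕ (p ∷ P) (q ∷ Q) g = begin
  ((p xor q) ∧ g zero) xor sumOver (P ⊕ Q) (g ∘ suc)
    ≡⟨ cong₂ _xor_ (∧-distribʳ-xor (g zero) p q) (sumOver-⊕ P Q (g ∘ suc)) ⟩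
  ((p ∧ g zero) xor (q ∧ g zero)) xor (sumOver P (g ∘ suc) xor sumOver Q (g ∘ suc))
    ≡⟨ xor-interchange (p ∧ g zero) (q ∧ g zero) (sumOver P (g ∘ suc)) (sumOver Q (g ∘ suc)) ⟩
  sumOver (p ∷ P) g xor sumOver (q ∷ Q) g ∎

sumOver-∪ : ∀ {n} (P Q : Subset n) g → (∀ {x} → x ∈ P → x ∉ Q) →
  sumOver (P ∪ Q) g ≡ sumOver P g xor sumOver Q g
sumOver-∪ []            []            g disj = refl
sumOver-∪ (inside  ∷ P) (inside  ∷ Q) g disj = ⊥-elim (disj here here)
sumOver-∪ (inside  ∷ P) (outside ∷ Q) g disj =
  trans (cong (g zero xor_) (sumOver-∪ P Q (g ∘ suc) (λ x∈P x∈Q → disj (there x∈P) (there x∈Q))))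
        (sym (xor-assoc (g zero) (sumOver P (g ∘ suc)) (sumOver Q (g ∘ suc))))
sumOver-∪ (outside ∷ P) (q       ∷ Q) g disj =
  trans (cong ((q ∧ g zero) xor_) (sumOver-∪ P Q (g ∘ suc) (λ x∈P x∈Q → disj (there x∈P) (there x∈Q))))
        (xor-swap (q ∧ g zero) (sumOver P (g ∘ suc)) (sumOver Q (g ∘ suc)))

sumOver-remove : ∀ {n} (Y : Subset n) {e} g → e ∈ Y → sumOver Y g ≡ g e xor sumOver (Y - e) g
sumOver-remove (inside ∷ Y) g here =
  cong (λ Q → g zero xor sumOver Q (g ∘ suc)) (sym (p─⊥≡p Y))
sumOver-remove (y ∷ Y) {suc e} g (there e∈Y) =
  trans (cong ((y ∧ g zero) xor_) (sumOver-remove Y (g ∘ suc) e∈Y))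
        (xor-swap (y ∧ g zero) (g (suc e)) (sumOver (Y - e) (g ∘ suc)))

sumOver-single : ∀ {n} (k : Fin n) g → sumOver ⁅ k ⁆ g ≡ g k
sumOver-single zero    g = trans (cong (g zero xor_) (sumOver-∅ (g ∘ suc))) (xor-identityʳ (g zero))
sumOver-single (suc k) g = sumOver-single k (g ∘ suc)

sumOver-δ : ∀ {n} (P : Subset n) i → sumOver P (δ i) ≡ lookup P i
sumOver-δ (p ∷ P) zero = begin
  (p ∧ true) xor sumOver P (λ _ → false)  ≡⟨ cong₂ _xor_ (∧-identityʳ p) (sumOver-zero P) ⟩
  p xor false                             ≡⟨ xor-identityʳ p ⟩
  p                                       ∎
sumOver-δ (p ∷ P) (suc i) =
  cong₂ _xor_ (∧-zeroʳ p) (trans (sumOver-cong P (λ {j} _ → δ-suc i j)) (sumOver-δ P i))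

sumOver-++ : ∀ {r m} (u : Subset r) (s : Subset m) g →
  sumOver (u ++ s) g ≡ sumOver u (λ k → g (k ↑ˡ m)) xor sumOver s (λ j → g (r ↑ʳ j))
sumOver-++ []                  s g = refl
sumOver-++ {suc r} {m} (p ∷ u) s g =
  trans (cong ((p ∧ g zero) xor_) (sumOver-++ u s (g ∘ suc)))
        (sym (xor-assoc (p ∧ g zero) (sumOver u (λ k → g (suc (k ↑ˡ m)))) (sumOver s (λ j → g (suc (r ↑ʳ j))))))

sum-closed : ∀ {r n} (Q : (Fin r → Bool) → Set) → Q (λ _ → false) →
  (∀ {u v} → Q u → Q v → Q (λ i → u i xor v i)) →
  (v : Fin n → Fin r → Bool) (W : Subset n) → (∀ {j} → j ∈ W → Q (v j)) →
  Q (λ i → sumOver W (λ j → v j i))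
sum-closed Q q0 q+ v []            _    = q0
sum-closed Q q0 q+ v (inside  ∷ W) memb = q+ (memb here) (sum-closed Q q0 q+ (v ∘ suc) W (memb ∘ there))
sum-closed Q q0 q+ v (outside ∷ W) memb = sum-closed Q q0 q+ (v ∘ suc) W (memb ∘ there)

lookup-∉ : ∀ {n} {x : Fin n} {P : Subset n} → x ∉ P → lookup P x ≡ false
lookup-∉ {x = x} {P} x∉P with lookup P x in eq
... | true  = contradiction (lookup⇒[]= x P eq) x∉P
... | false = refl

img-elem : ∀ {m n} (f : Fin m → Fin n) W {e} → e ∈ img f W → ∃ λ i → i ∈ W × f i ≡ e
img-elem {Nat.zero} f []          e∈ = ⊥-elim (∉⊥ e∈)
img-elem {suc m}    f (true ∷ W)  e∈ with x∈p∪q⁻ ⁅ f zero ⁆ (img (f ∘ suc) W) e∈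
... | inj₁ e∈⁅⁆ = zero , here , sym (x∈⁅y⁆⇒x≡y (f zero) e∈⁅⁆)
... | inj₂ e∈fW = Product.map suc (Product.map₁ there) (img-elem (f ∘ suc) W e∈fW)
img-elem {suc m}    f (false ∷ W) e∈ = Product.map suc (Product.map₁ there) (img-elem (f ∘ suc) W e∈)

img-intro : ∀ {m n} (f : Fin m → Fin n) W {i} → i ∈ W → f i ∈ img f W
img-intro f (true  ∷ W) here       = x∈p∪q⁺ (inj₁ (x∈⁅x⁆ (f zero)))
img-intro f (true  ∷ W) (there i∈) = x∈p∪q⁺ (inj₂ (img-intro (f ∘ suc) W i∈))
img-intro f (false ∷ W) (there i∈) = img-intro (f ∘ suc) W i∈

img-reflect : ∀ {m n} (f : Fin m → Fin n) → Injective _≡_ _≡_ f → ∀ W {i} → f i ∈ img f W → i ∈ W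
img-reflect f f-inj W fi∈ with img-elem f W fi∈
... | i' , i'∈W , fi'≡fi = subst (_∈ W) (f-inj fi'≡fi) i'∈W

img-lookup : ∀ {m n} (f : Fin m → Fin n) → Injective _≡_ _≡_ f → ∀ W i → lookup (img f W) (f i) ≡ lookup W i
img-lookup f f-inj W i with lookup W i in eq
... | true  = []=⇒lookup (img-intro f W (lookup⇒[]= i W eq))
... | false = lookup-∉ λ fi∈ → contradiction (trans (sym ([]=⇒lookup (img-reflect f f-inj W fi∈))) eq) λ ()

sumOver-img : ∀ {m n} (f : Fin m → Fin n) → Injective _≡_ _≡_ f → ∀ W g →
  sumOver (img f W) g ≡ sumOver W (g ∘ f)
sumOver-img {Nat.zero} f f-inj []          g = sumOver-∅ g
sumOver-img {suc m}    f f-inj (true ∷ W)  g = begin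
  sumOver (⁅ f zero ⁆ ∪ img (f ∘ suc) W) g
    ≡⟨ sumOver-∪ ⁅ f zero ⁆ (img (f ∘ suc) W) g fresh ⟩
  sumOver ⁅ f zero ⁆ g xor sumOver (img (f ∘ suc) W) g
    ≡⟨ cong₂ _xor_ (sumOver-single (f zero) g) (sumOver-img (f ∘ suc) (suc-injective ∘ f-inj) W g) ⟩
  g (f zero) xor sumOver W (g ∘ f ∘ suc) ∎
  where
  fresh : ∀ {x} → x ∈ ⁅ f zero ⁆ → x ∉ img (f ∘ suc) W
  fresh x∈ x∈img with img-elem (f ∘ suc) W x∈img
  ... | i , _ , fi≡x with f-inj (trans fi≡x (x∈⁅y⁆⇒x≡y (f zero) x∈))
  ... | ()
sumOver-img {suc m}    f f-inj (false ∷ W) g = sumOver-img (f ∘ suc) (suc-injective ∘ f-inj) W g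

searchSubsets : ∀ {n} (X : Subset n) {P : Subset n → Set} → (∀ Y → Dec (P Y)) →
  (∀ Y → Y ⊆ X → P Y) ⊎ (∃ λ Y → Y ⊆ X × ¬ P Y)
searchSubsets [] P? with P? []
... | yes p  = inj₁ λ { [] _ → p }
... | no ¬p  = inj₂ ([] , id , ¬p)
searchSubsets (outside ∷ X) P? with searchSubsets X (P? ∘ (outside ∷_))
... | inj₁ all = inj₁ λ { (outside ∷ Y) Y⊆ → all Y (drop-∷-⊆ Y⊆)
                        ; (inside ∷ Y) Y⊆ → contradiction (Y⊆ here) λ () }
... | inj₂ (Y , Y⊆ , ¬p) = inj₂ (outside ∷ Y , out⊆ Y⊆ , ¬p)
searchSubsets (inside ∷ X) P? with searchSubsets X (P? ∘ (inside ∷_)) | searchSubsets X (P? ∘ (outside ∷_))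
... | inj₁ all-in | inj₁ all-out = inj₁ λ { (inside ∷ Y) Y⊆ → all-in Y (drop-∷-⊆ Y⊆)
                                         ; (outside ∷ Y) Y⊆ → all-out Y (drop-∷-⊆ Y⊆) }
... | inj₂ (Y , Y⊆ , ¬p) | _                    = inj₂ (inside ∷ Y , in⊆in Y⊆ , ¬p)
... | inj₁ _             | inj₂ (Y , Y⊆ , ¬p)  = inj₂ (outside ∷ Y , out⊆ Y⊆ , ¬p)

dualBasis : ∀ {n} (M : Matroid n) B → Basis M B → Basis (dual M) (∁ B)
dualBasis M B basisB@(indB , _) = (B , basisB , x∉p⇒x∈∁p ∘ x∈p⇒x∉∁p) , maximal
  where
  maximal : ∀ X → ∁ B ⊆ X → Ind (dual M) X → X ⊆ ∁ B
  maximal X ∁B⊆X (B' , (_ , maxB') , B'⊆∁X) {x} x∈X with x ∈? B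
  ... | no x∉B  = x∉p⇒x∈∁p x∉B
  ... | yes x∈B = contradiction x∈X (x∈∁p⇒x∉p (B'⊆∁X (maxB' B B'⊆B indB x∈B)))
    where
    B'⊆B : B' ⊆ B
    B'⊆B y∈B' = x∉∁p⇒x∈p λ y∈∁B → x∈∁p⇒x∉p (B'⊆∁X y∈B') (∁B⊆X y∈∁B)

module VectorMatroid {r n : ℕ} (A : Matrix r n) where

  M : Matroid n
  M = vecMatroid A

  col : Fin n → Fin r → Bool
  col e i = A i e

  InSpan : Subset n → (Fin r → Bool) → Set
  InSpan Z v = ∃ λ W → W ⊆ Z × (∀ i → sumOver W (A i) ≡ v i)

  Spans : Subset n → Set
  Spans Z = ∀ e → InSpan Z (col e)

  SumsToZero : Subset n → Set
  SumsToZero Y = ∀ i → colSum A Y i ≡ false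

  span-zero : ∀ {Z} → InSpan Z (λ _ → false)
  span-zero = ∅ , (λ m → ⊥-elim (∉⊥ m)) , λ i → sumOver-∅ (A i)

  span-col : ∀ {Z e} → e ∈ Z → InSpan Z (col e)
  span-col {e = e} e∈Z = ⁅ e ⁆ , ⁅⁆-⊆ e∈Z , λ i → sumOver-single e (A i)

  span-xor : ∀ {Z u v} → InSpan Z u → InSpan Z v → InSpan Z (λ i → u i xor v i)
  span-xor (W , W⊆Z , sumW) (W' , W'⊆Z , sumW') =
    W ⊕ W' , [ W⊆Z , W'⊆Z ]′ ∘ ∈-⊕ W W' ,
    λ i → trans (sumOver-⊕ W W' (A i)) (cong₂ _xor_ (sumW i) (sumW' i))

  span-cong : ∀ {Z u v} → InSpan Z u → (∀ i → u i ≡ v i) → InSpan Z v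
  span-cong (W , W⊆Z , sumW) u≗v = W , W⊆Z , λ i → trans (sumW i) (u≗v i)

  span-mono : ∀ {Z Z' v} → Z ⊆ Z' → InSpan Z v → InSpan Z' v
  span-mono Z⊆Z' (W , W⊆Z , sumW) = W , Z⊆Z' ∘ W⊆Z , sumW

  span-sum : ∀ {Z} W → (∀ {j} → j ∈ W → InSpan Z (col j)) → InSpan Z (λ i → sumOver W (A i))
  span-sum {Z} = sum-closed (InSpan Z) span-zero span-xor col

  span-from-units : ∀ {Z} v → (∀ {k} → v k ≡ true → InSpan Z (unit k)) → InSpan Z v
  span-from-units {Z} v units =
    span-cong (sum-closed (InSpan Z) span-zero span-xor unit (tabulate v) unitsOnSupport)
              (λ i → trans (sumOver-δ (tabulate v) i) (lookup∘tabulate v i))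
    where
    unitsOnSupport : ∀ {k} → k ∈ tabulate v → InSpan Z (unit k)
    unitsOnSupport {k} k∈ = units (trans (sym (lookup∘tabulate v k)) ([]=⇒lookup k∈))

  units-span : ∀ {Z} → (∀ k → InSpan Z (unit k)) → Spans Z
  units-span units e = span-from-units (col e) (λ {k} _ → units k)

  sumsToZero? : ∀ Y → Dec (SumsToZero Y)
  sumsToZero? Y = all? λ i → colSum A Y i ≟ᵇ false

  classify : ∀ X → Ind M X ⊎ (∃ λ Y → Y ⊆ X × Nonempty Y × SumsToZero Y)
  classify X with searchSubsets X (λ Y → nonempty? Y →-dec ¬? (sumsToZero? Y))
  ... | inj₁ noZeroSum = inj₁ noZeroSum
  ... | inj₂ (Y , Y⊆X , hasZeroSum) with nonempty? Y | sumsToZero? Y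
  ...   | yes ne  | yes sum0 = inj₂ (Y , Y⊆X , ne , sum0)
  ...   | no ¬ne  | _        = contradiction (λ ne → contradiction ne ¬ne) hasZeroSum
  ...   | yes _   | no ¬zero = contradiction (λ _ → ¬zero) hasZeroSum

  independent? : ∀ X → Dec (Ind M X)
  independent? X with classify X
  ... | inj₁ indX                  = yes indX
  ... | inj₂ (Y , Y⊆X , ne , sum0) = no λ indX → indX Y Y⊆X ne sum0

  dependent-subset : ∀ {X} → ¬ Ind M X → ∃ λ Y → Y ⊆ X × Nonempty Y × SumsToZero Y
  dependent-subset {X} depX with classify X
  ... | inj₁ indX = contradiction indX depX
  ... | inj₂ dep  = dep

  ind-mono : ∀ {X Y} → Ind M X → Y ⊆ X → Ind M Y
  ind-mono indX Y⊆X W W⊆Y = indX W (Y⊆X ∘ W⊆Y)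

  ind-∅ : Ind M ∅
  ind-∅ Y Y⊆∅ (x , x∈Y) _ = ∉⊥ (Y⊆∅ x∈Y)

  extract : ∀ {B e} → Ind M B → ¬ Ind M (B ∪ ⁅ e ⁆) → InSpan B (col e)
  extract {B} {e} indB depBe with dependent-subset depBe
  ... | Y , Y⊆Be , ne , sum0 with e ∈? Y
  ...   | no e∉Y  = ⊥-elim (indB Y Y⊆B ne sum0)
    where
    Y⊆B : Y ⊆ B
    Y⊆B y∈Y = [ id , (λ y∈e → contradiction (subst (_∈ Y) (x∈⁅y⁆⇒x≡y e y∈e) y∈Y) e∉Y) ]′
                (x∈p∪q⁻ B ⁅ e ⁆ (Y⊆Be y∈Y))
  ...   | yes e∈Y = Y - e , Y-e⊆B , sumY-e
    where
    Y-e⊆B : Y - e ⊆ B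
    Y-e⊆B {y} y∈ = [ id , (λ y∈e → contradiction (subst (_∈ Y - e) (x∈⁅y⁆⇒x≡y e y∈e) y∈) (∉-remove Y e)) ]′
                     (x∈p∪q⁻ B ⁅ e ⁆ (Y⊆Be (p─q⊆p Y ⁅ e ⁆ y∈)))
    sumY-e : ∀ i → sumOver (Y - e) (A i) ≡ A i e
    sumY-e i = sym (xor≡false⇒≡ (A i e) (sumOver (Y - e) (A i)) (begin
      A i e xor sumOver (Y - e) (A i)  ≡⟨ sym (sumOver-remove Y (A i) e∈Y) ⟩
      sumOver Y (A i)                  ≡⟨ sym (colSum≡sumOver A Y i) ⟩
      colSum A Y i                     ≡⟨ sum0 i ⟩
      false                            ∎))

  basisOf : ∀ {B} → Ind M B → Spans B → Basis M B
  basisOf {B} indB spansB = indB , maximal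
    where
    maximal : ∀ X → B ⊆ X → Ind M X → X ⊆ B
    maximal X B⊆X indX {x} x∈X with x ∈? B
    ... | yes x∈B = x∈B
    ... | no x∉B with spansB x
    ...   | V , V⊆B , sumV = ⊥-elim (indX (V ∪ ⁅ x ⁆) (∪-⊆ (B⊆X ∘ V⊆B) (⁅⁆-⊆ x∈X))
                                        (x , x∈p∪q⁺ (inj₂ (x∈⁅x⁆ x))) sumsToZero)
      where
      fresh : ∀ {y} → y ∈ V → y ∉ ⁅ x ⁆
      fresh y∈V y∈x = x∉B (V⊆B (subst (_∈ V) (x∈⁅y⁆⇒x≡y x y∈x) y∈V))
      sumsToZero : SumsToZero (V ∪ ⁅ x ⁆)
      sumsToZero i = begin
        colSum A (V ∪ ⁅ x ⁆) i                  ≡⟨ colSum≡sumOver A (V ∪ ⁅ x ⁆) i ⟩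
        sumOver (V ∪ ⁅ x ⁆) (A i)               ≡⟨ sumOver-∪ V ⁅ x ⁆ (A i) fresh ⟩
        sumOver V (A i) xor sumOver ⁅ x ⁆ (A i) ≡⟨ cong₂ _xor_ (sumV i) (sumOver-single x (A i)) ⟩
        A i x xor A i x                         ≡⟨ xor-same (A i x) ⟩
        false                                   ∎

  -- Greedy extension: scanning the candidates l, an independent I ⊆ Z grows
  -- to an independent B ⊆ Z whose span contains every candidate lying in Z.
  Extension : Subset n → List (Fin n) → Subset n → Set
  Extension Z l I = ∃ λ B → I ⊆ B × B ⊆ Z × Ind M B × (∀ {e} → e ∈ˡ l → e ∈ Z → InSpan B (col e))

  extend : ∀ Z l I → Ind M I → I ⊆ Z → Extension Z l I
  extend Z []ˡ       I indI I⊆Z = I , id , I⊆Z , indI , λ ()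
  extend Z (e ∷ˡ l) I indI I⊆Z with e ∈? Z | independent? (I ∪ ⁅ e ⁆)
  ... | yes e∈Z | yes indIe with extend Z l (I ∪ ⁅ e ⁆) indIe (∪-⊆ I⊆Z (⁅⁆-⊆ e∈Z))
  ...   | B , Ie⊆B , B⊆Z , indB , inSpan =
          B , Ie⊆B ∘ p⊆p∪q ⁅ e ⁆ , B⊆Z , indB ,
          λ { (hereˡ refl) _ → span-col (Ie⊆B (x∈p∪q⁺ (inj₂ (x∈⁅x⁆ e)))) ; (thereˡ e'∈l) → inSpan e'∈l }
  extend Z (e ∷ˡ l) I indI I⊆Z | yes e∈Z | no depIe with extend Z l I indI I⊆Z
  ...   | B , I⊆B , B⊆Z , indB , inSpan =
          B , I⊆B , B⊆Z , indB ,
          λ { (hereˡ refl) _ → span-mono I⊆B (extract indI depIe) ; (thereˡ e'∈l) → inSpan e'∈l }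
  extend Z (e ∷ˡ l) I indI I⊆Z | no e∉Z | _ with extend Z l I indI I⊆Z
  ...   | B , I⊆B , B⊆Z , indB , inSpan =
          B , I⊆B , B⊆Z , indB ,
          λ { (hereˡ refl) e∈Z → contradiction e∈Z e∉Z ; (thereˡ e'∈l) → inSpan e'∈l }

  extendToBasis : ∀ Z I → Spans Z → Ind M I → I ⊆ Z → ∃ λ B → Basis M B × I ⊆ B × B ⊆ Z
  extendToBasis Z I spansZ indI I⊆Z with extend Z (allFin n) I indI I⊆Z
  ... | B , I⊆B , B⊆Z , indB , inSpan = B , basisOf indB spansB , I⊆B , B⊆Z
    where
    spansB : Spans B
    spansB e with spansZ e
    ... | W , W⊆Z , sumW = span-cong (span-sum W (λ {j} j∈W → inSpan (∈-allFin j) (W⊆Z j∈W))) sumW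

  dualInd⇒coSpans : ∀ X → Ind (dual M) X → Spans (∁ X)
  dualInd⇒coSpans X (B , (indB , maxB) , B⊆∁X) e with e ∈? B
  ... | yes e∈B = span-mono B⊆∁X (span-col e∈B)
  ... | no e∉B  = span-mono B⊆∁X (extract indB λ indBe →
                    e∉B (maxB (B ∪ ⁅ e ⁆) (p⊆p∪q ⁅ e ⁆) indBe (x∈p∪q⁺ (inj₂ (x∈⁅x⁆ e)))))

  coSpans⇒dualInd : ∀ X → Spans (∁ X) → Ind (dual M) X
  coSpans⇒dualInd X spans with extendToBasis (∁ X) ∅ spans ind-∅ (λ m → ⊥-elim (∉⊥ m))
  ... | B , basisB , _ , B⊆∁X = B , basisB , B⊆∁X

  ind⇒ind** : ∀ {X} → Ind M X → Ind (dual (dual M)) X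
  ind⇒ind** {X} indX with extendToBasis ⊤ X (λ e → span-col ∈⊤) indX ⊆⊤
  ... | B , basisB , X⊆B , _ =
        ∁ B , dualBasis M B basisB , λ y∈∁B → x∉p⇒x∈∁p λ y∈X → x∈∁p⇒x∉p y∈∁B (X⊆B y∈X)

  ind**⇒ind : ∀ {D} → Ind (dual (dual M)) D → Ind M D
  ind**⇒ind {D} (B , (indB , maxB) , B⊆∁D) with indB
  ... | B₀ , basisB₀ , B₀⊆∁B = ind-mono (proj₁ basisB₀) D⊆B₀
    where
    D⊆B₀ : D ⊆ B₀
    D⊆B₀ {e} e∈D with e ∈? B₀
    ... | yes e∈B₀ = e∈B₀
    ... | no e∉B₀  = ⊥-elim (e∉B (maxB (B ∪ ⁅ e ⁆) (p⊆p∪q ⁅ e ⁆) indBe (x∈p∪q⁺ (inj₂ (x∈⁅x⁆ e)))))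
      where
      e∉B : e ∉ B
      e∉B e∈B = x∈∁p⇒x∉p (B⊆∁D e∈B) e∈D
      avoids : ∀ {y} → y ∈ B₀ → y ∉ B ∪ ⁅ e ⁆
      avoids y∈B₀ y∈Be = [ x∈∁p⇒x∉p (B₀⊆∁B y∈B₀) , (λ y∈e → e∉B₀ (subst (_∈ B₀) (x∈⁅y⁆⇒x≡y e y∈e) y∈B₀)) ]′
                           (x∈p∪q⁻ B ⁅ e ⁆ y∈Be)
      indBe : Ind (dual M) (B ∪ ⁅ e ⁆)
      indBe = B₀ , basisB₀ , x∉p⇒x∈∁p ∘ avoids

  circuit⇒cocircuit-of-dual : ∀ {C} → Circuit M C → Cocircuit (dual M) C
  circuit⇒cocircuit-of-dual (depC , minimal) = depC ∘ ind**⇒ind , λ e e∈C → ind⇒ind** (minimal e e∈C)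

  circuit? : ∀ C → Dec (Circuit M C)
  circuit? C = ¬? (independent? C) ×-dec all? (λ e → e ∈? C →-dec independent? (C - e))

  -- If the sum of the rows of A indexed by R is the indicator vector of a
  -- nonempty set T, then ∁T cannot span, so T is dependent in M*.
  rowSum-dependent : ∀ T R → (∀ x → sumOver R (col x) ≡ lookup T x) → Nonempty T → ¬ Ind (dual M) T
  rowSum-dependent T R rowsT (e , e∈T) indT with dualInd⇒coSpans T indT e
  ... | W , W⊆∁T , sumW = contradiction (begin
          true                                ≡⟨ sym ([]=⇒lookup e∈T) ⟩
          lookup T e                          ≡⟨ sym (rowsT e) ⟩
          sumOver R (col e)                   ≡⟨ sumOver-cong R (λ {i} _ → sym (sumW i)) ⟩
          sumOver R (λ i → sumOver W (A i))   ≡⟨ orthogonal ⟩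
          false                               ∎) λ ()
    where
    orthogonal : sumOver R (λ i → sumOver W (A i)) ≡ false
    orthogonal = sum-closed (λ v → sumOver R v ≡ false) (sumOver-zero R)
                   (λ {u} {v} Ru Rv → trans (sumOver-linear R u v) (cong₂ _xor_ Ru Rv)) col W
                   (λ {j} j∈W → trans (rowsT j) (lookup-∉ (x∈∁p⇒x∉p (W⊆∁T j∈W))))

module Standard {r m : ℕ} (X : Matrix r m) where
  open VectorMatroid (stdRep X) public

  identity-block : ∀ i k → stdRep X i (k ↑ˡ m) ≡ δ i k
  identity-block i k rewrite splitAt-↑ˡ r k m = refl

  X-block : ∀ i j → stdRep X i (r ↑ʳ j) ≡ X i j
  X-block i j rewrite splitAt-↑ʳ r m j = refl

  sumOver-rows : ∀ (u : Subset r) s i → sumOver (u ++ s) (stdRep X i) ≡ lookup u i xor sumOver s (X i)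
  sumOver-rows u s i = begin
    sumOver (u ++ s) (stdRep X i)
      ≡⟨ sumOver-++ u s (stdRep X i) ⟩
    sumOver u (λ k → stdRep X i (k ↑ˡ m)) xor sumOver s (λ j → stdRep X i (r ↑ʳ j))
      ≡⟨ cong₂ _xor_ (trans (sumOver-cong u (λ {k} _ → identity-block i k)) (sumOver-δ u i))
                     (sumOver-cong s (λ {j} _ → X-block i j)) ⟩
    lookup u i xor sumOver s (X i) ∎

  -- The unit vector e_k is the sum of the X-columns in s together with the
  -- identity columns on the support of e_k + Σ_{j ∈ s} X_j.
  unitWitness : Fin r → Subset m → Subset (r + m)
  unitWitness k s = tabulate (λ i → δ i k xor sumOver s (X i)) ++ s

  unitWitness-sum : ∀ k s i → sumOver (unitWitness k s) (stdRep X i) ≡ δ i k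
  unitWitness-sum k s i = begin
    sumOver (unitWitness k s) (stdRep X i)  ≡⟨ sumOver-rows (tabulate (λ i' → δ i' k xor Xs i')) s i ⟩
    lookup (tabulate (λ i' → δ i' k xor Xs i')) i xor Xs i
                                            ≡⟨ cong (_xor Xs i) (lookup∘tabulate (λ i' → δ i' k xor Xs i') i) ⟩
    (δ i k xor Xs i) xor Xs i               ≡⟨ xor-assoc (δ i k) (Xs i) (Xs i) ⟩
    δ i k xor (Xs i xor Xs i)               ≡⟨ cong (δ i k xor_) (xor-same (Xs i)) ⟩
    δ i k xor false                         ≡⟨ xor-identityʳ (δ i k) ⟩
    δ i k                                   ∎
    where
    Xs : Fin r → Bool
    Xs i' = sumOver s (X i')

  SpanCertificate : Subset (r + m) → Set
  SpanCertificate Z = ∀ k → ∃ λ s → unitWitness k s ⊆ Z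

  spanCertificate? : ∀ Z → Dec (SpanCertificate Z)
  spanCertificate? Z = all? λ k → anySubset? λ s → unitWitness k s ⊆? Z

  certificate⇒spans : ∀ {Z} → SpanCertificate Z → Spans Z
  certificate⇒spans cert = units-span λ k →
    let (s , s⊆Z) = cert k in unitWitness k s , s⊆Z , unitWitness-sum k s

  -- The identity rows met by T; if T is a cocircuit of M[I_r | X], the sum
  -- of these rows of [I_r | X] is the indicator vector of T.
  rowsOf : Subset (r + m) → Subset r
  rowsOf T = tabulate λ i → lookup T (i ↑ˡ m)

  TriangleCertificate : Subset (r + m) → Set
  TriangleCertificate T =
    (∀ x → sumOver (rowsOf T) (col x) ≡ lookup T x) × Nonempty T
    × (∀ e → e ∈ T → SpanCertificate (∁ (T - e))) × ∣ T ∣ ≡ 3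

  triangleCertificate? : ∀ T → Dec (TriangleCertificate T)
  triangleCertificate? T =
    all? (λ x → sumOver (rowsOf T) (col x) ≟ᵇ lookup T x) ×-dec nonempty? T
    ×-dec all? (λ e → e ∈? T →-dec spanCertificate? (∁ (T - e))) ×-dec (∣ T ∣ ≟ⁿ 3)

  -- A certified set is a triangle of the dual: dependent by the row sum,
  -- and each T - e is independent because its complement spans.
  certified-triangle : ∀ {T} → TriangleCertificate T → Triangle (dual M) T
  certified-triangle {T} (rowsT , ne , spans , size) =
    (rowSum-dependent T (rowsOf T) rowsT ne ,
     λ e e∈T → coSpans⇒dualInd (T - e) (certificate⇒spans (spans e e∈T))) ,
    size

module E₁Rep = Standard E1'mat
module SRep  = Standard Emat

-- The ring of bowties in E₁*: T₀ = {1,10,5}, T₁ = {9,14,6}, T₂ = {12,11,8},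
-- T₃ = {3,2,7}.  The c_j are the identity columns 5,…,8 of the rows added to E.
a b c : Fin 4 → Fin 15
a = lookup (# 1  ∷ # 9  ∷ # 12 ∷ # 3 ∷ [])
b = lookup (# 10 ∷ # 14 ∷ # 11 ∷ # 2 ∷ [])
c = lookup (# 5  ∷ # 6  ∷ # 8  ∷ # 7 ∷ [])

pairwise-distinct : ∀ j j' t t' → triElt a b c j t ≡ triElt a b c j' t' → j ≡ j' × t ≡ t'
pairwise-distinct = toWitness {a? = all? λ j → all? λ j' → all? λ t → all? λ t' →
  triElt a b c j t ≟ triElt a b c j' t' →-dec (j ≟ j' ×-dec t ≟ t')} tt

triangleCertificates : ∀ j → E₁Rep.TriangleCertificate (Tri a b c j)
triangleCertificates = toWitness {a? = all? λ j → E₁Rep.triangleCertificate? (Tri a b c j)} tt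

circuits : ∀ j → Circuit E₁ (Dset a b c j)
circuits = toWitness {a? = all? λ j → E₁Rep.circuit? (Dset a b c j)} tt

ring : RingOfBowties (dual E₁) 3 a b c
ring = s≤s (s≤s z≤n) , pairwise-distinct ,
       E₁Rep.certified-triangle ∘ triangleCertificates ,
       E₁Rep.circuit⇒cocircuit-of-dual ∘ circuits

φ : Fin 11 → Fin 15
φ x = [ (λ k → (k ↑ˡ 4) ↑ˡ 6) , (λ j → 9 ↑ʳ j) ]′ (splitAt 5 x)

-- The first five rows of E₁′ are the rows of E.
top : Fin 5 → Fin 9
top k = k ↑ˡ 4

C : Subset 15
C = cSet c

φ-injective : Injective _≡_ _≡_ φ
φ-injective {x} {y} = toWitness {a? = all? λ x → all? λ y → φ x ≟ φ y →-dec x ≟ y} tt x y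

φ-avoids-C : ∀ x → φ x ∉ C
φ-avoids-C = toWitness {a? = all? λ x → ¬? (φ x ∈? C)} tt

φ-covers : ∀ e → e ∉ C → ∃ λ x → φ x ≡ e
φ-covers = toWitness {a? = all? λ e → ¬? (e ∈? C) →-dec any? λ x → φ x ≟ e} tt

top-rows : ∀ k x → stdRep E1'mat (top k) (φ x) ≡ stdRep Emat k x
top-rows = toWitness {a? = all? λ k → all? λ x → stdRep E1'mat (top k) (φ x) ≟ᵇ stdRep Emat k x} tt

top-rows-vanish : ∀ k e → e ∈ C → stdRep E1'mat (top k) e ≡ false
top-rows-vanish = toWitness {a? = all? λ k → all? λ e → e ∈? C →-dec stdRep E1'mat (top k) e ≟ᵇ false} tt

rows-split : ∀ i → (∃ λ k → top k ≡ i) ⊎ (i ↑ˡ 6 ∈ C)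
rows-split = toWitness {a? = all? λ i → any? (λ k → top k ≟ i) ⊎-dec (i ↑ˡ 6 ∈? C)} tt

-- For Y ⊆ E(S): ∁Y spans S iff Z = ∁φ(Y) spans E₁.  Note Z ⊇ C, and
-- modulo the span of C the columns of E₁ on φ(E(S)) are those of S.
module Correspondence (Y : Subset 11) where

  Z : Subset 15
  Z = ∁ (img φ Y)

  C⊆Z : C ⊆ Z
  C⊆Z e∈C = x∉p⇒x∈∁p λ e∈φY → let (x , _ , φx≡e) = img-elem φ Y e∈φY in
                                 φ-avoids-C x (subst (_∈ C) (sym φx≡e) e∈C)

  φ-preserves-complement : ∀ {x} → x ∈ ∁ Y → φ x ∈ Z
  φ-preserves-complement x∈∁Y = x∉p⇒x∈∁p λ φx∈φY →
    x∈∁p⇒x∉p x∈∁Y (img-reflect φ φ-injective Y φx∈φY)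

  φ-reflects-complement : ∀ {x} → φ x ∈ Z → x ∈ ∁ Y
  φ-reflects-complement φx∈Z = x∉p⇒x∈∁p λ x∈Y → x∈∁p⇒x∉p φx∈Z (img-intro φ Y x∈Y)

  top-sum : ∀ W k → sumOver (img φ W) (stdRep E1'mat (top k)) ≡ sumOver W (stdRep Emat k)
  top-sum W k = trans (sumOver-img φ φ-injective W (stdRep E1'mat (top k)))
                      (sumOver-cong W λ {x} _ → top-rows k x)

  module FromS (spansS : SRep.Spans (∁ Y)) where
    open E₁Rep

    bottom-unit : ∀ {i} → i ↑ˡ 6 ∈ C → InSpan Z (unit i)
    bottom-unit {i} i∈C = span-cong (span-col (C⊆Z i∈C)) λ i' → identity-block i' i

    bottom-supported : ∀ v → (∀ k → v (top k) ≡ false) → InSpan Z v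
    bottom-supported v v-top = span-from-units v λ {i} vi → case i vi (rows-split i)
      where
      case : ∀ i → v i ≡ true → (∃ λ k → top k ≡ i) ⊎ (i ↑ˡ 6 ∈ C) → InSpan Z (unit i)
      case i vi (inj₁ (k , refl)) = contradiction (trans (sym vi) (v-top k)) λ ()
      case i vi (inj₂ i∈C)        = bottom-unit i∈C

    -- e_{top k}: lift an S-combination giving e_k and correct it on the bottom rows.
    top-unit : ∀ k → InSpan Z (unit (top k))
    top-unit k with spansS (k ↑ˡ 6)
    ... | W , W⊆∁Y , sumW =
          span-cong (span-xor liftInSpan (bottom-supported correction correction-top))
                    (λ i → xor-cancelˡ (lift i) (unit (top k) i))
      where
      lift : Fin 9 → Bool
      lift i = sumOver (img φ W) (stdRep E1'mat i)
      liftInSpan : InSpan Z lift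
      liftInSpan = img φ W , (λ e∈ → let (x , x∈W , φx≡e) = img-elem φ W e∈ in
                                     subst (_∈ Z) φx≡e (φ-preserves-complement (W⊆∁Y x∈W))) ,
                   λ i → refl
      correction : Fin 9 → Bool
      correction i = lift i xor unit (top k) i
      correction-top : ∀ k' → correction (top k') ≡ false
      correction-top k' = begin
        lift (top k') xor δ (top k') (top k) ≡⟨ cong₂ _xor_ (top-sum W k') (δ-injective top (↑ˡ-injective 4 _ _) k' k) ⟩
        sumOver W (stdRep Emat k') xor δ k' k ≡⟨ cong (_xor δ k' k) (trans (sumW k') (SRep.identity-block k' k)) ⟩
        δ k' k xor δ k' k                    ≡⟨ xor-same (δ k' k) ⟩
        false                                ∎

    spans-E₁ : Spans Z
    spans-E₁ = units-span λ i → [ (λ { (k , refl) → top-unit k }) , bottom-unit ]′ (rows-split i)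

  module FromE₁ (spansE : E₁Rep.Spans Z) where
    open SRep

    -- e_k: pull back an E₁-combination giving e_{top k} along φ.
    s-unit : ∀ k → InSpan (∁ Y) (unit k)
    s-unit k with spansE (top k ↑ˡ 6)
    ... | W' , W'⊆Z , sumW' = W , W⊆∁Y , sumW
      where
      W : Subset 11
      W = tabulate λ x → lookup W' (φ x)
      W-lookup : ∀ x → lookup W x ≡ lookup W' (φ x)
      W-lookup = lookup∘tabulate (λ x → lookup W' (φ x))
      W⊆∁Y : W ⊆ ∁ Y
      W⊆∁Y {x} x∈W = φ-reflects-complement (W'⊆Z (lookup⇒[]= (φ x) W' (trans (sym (W-lookup x)) ([]=⇒lookup x∈W))))
      agree : ∀ k' e → stdRep E1'mat (top k') e ≡ true → lookup (img φ W) e ≡ lookup W' e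
      agree k' e nonzero with e ∈? C
      ... | yes e∈C = contradiction (trans (sym nonzero) (top-rows-vanish k' e e∈C)) λ ()
      ... | no e∉C with φ-covers e e∉C
      ...   | x , refl = trans (img-lookup φ φ-injective W x) (W-lookup x)
      sumW : ∀ k' → sumOver W (stdRep Emat k') ≡ δ k' k
      sumW k' = begin
        sumOver W (stdRep Emat k')                 ≡⟨ sym (top-sum W k') ⟩
        sumOver (img φ W) (stdRep E1'mat (top k')) ≡⟨ sumOver-agree (img φ W) W' _ (agree k') ⟩
        sumOver W' (stdRep E1'mat (top k'))        ≡⟨ sumW' (top k') ⟩
        stdRep E1'mat (top k') (top k ↑ˡ 6)        ≡⟨ E₁Rep.identity-block (top k') (top k) ⟩
        δ (top k') (top k)                         ≡⟨ δ-injective top (↑ˡ-injective 4 _ _) k' k ⟩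
        δ k' k                                     ∎

    spans-S : Spans (∁ Y)
    spans-S = units-span s-unit

iso : IsoToDeletion (dual S) (dual E₁) C
iso = φ , φ-injective , φ-avoids-C , φ-covers , λ Y →
  (λ indY → E₁Rep.coSpans⇒dualInd (img φ Y)
              (Correspondence.FromS.spans-E₁ Y (SRep.dualInd⇒coSpans Y indY))) ,
  (λ indφY → SRep.coSpans⇒dualInd Y
              (Correspondence.FromE₁.spans-S Y (E₁Rep.dualInd⇒coSpans (img φ Y) indφY)))

proposition3p9 : Σ ℕ λ k → Σ (Fin (suc k) → Fin 15) λ a → Σ (Fin (suc k) → Fin 15) λ b → Σ (Fin (suc k) → Fin 15) λ c →
    RingOfBowties (dual E₁) k a b c × IsoToDeletion (dual S) (dual E₁) (cSet c)
proposition3p9 = 3 , a , b , c , ring , iso
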